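{- Let $\mathbf{x}^*$ be (the $\mathbf{x}$-part of) an optimal solution to the mixed integer program $$\min\ \mathbf{C}^T\mathbf{x}+\underline{\mathbf{c}}^T\mathbf{y}+\mathbf{u}^T\mathbf{b}\quad\text{s.t.}\quad \mathbf{H}(\mathbf{y}+\mathbf{x})\ge\mathbf{g},\ \mathbf{x}+\mathbf{y}\le\mathbf{1},\ \mathbf{u}^T\mathbf{A}\ge\mathbf{y}^T,\ \mathbf{x},\mathbf{y}\in\{0,1\}^n,\ \mathbf{u}\ge\mathbf{0}. \quad (\ast)$$ Then $\mathbf{x}^*\in\mathcal{X}'$ is a $\rho$-approximate first-stage solution to the robust two-stage problem, i.e. $\textsc{Eval}(\mathbf{x}^*)\le\rho\cdot\min_{\mathbf{x}\in\mathcal{X}'}\textsc{Eval}(\mathbf{x})$, where $\rho$ is the integrality gap of $(\ast)$, i.e. the ratio of the optimal value of $(\ast)$ to the optimal value of its LP relaxation (obtained by replacing $\mathbf{x},\mathbf{y}\in\{0,1\}^n$ with $\mathbf{0}\le\mathbf{x}\le\mathbf{1}$, $\mathbf{0}\le\mathbf{y}\le\mathbf{1}$).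
   Context: Let $\mathcal{X}=\{\mathbf{x}\in\{0,1\}^n:\mathbf{H}\mathbf{x}\ge\mathbf{g}\}$ (no integrality assumption on the associated polyhedron), $\mathbf{C}\in\mathbb{R}^n_{\ge0}$ the first-stage costs. For $\mathbf{x}\in\{0,1\}^n$ let $\mathcal{R}(\mathbf{x})=\{\mathbf{y}\in\{0,1\}^n:\mathbf{x}+\mathbf{y}\in\mathcal{X}\}$ and $\mathcal{X}'=\{\mathbf{x}\in\{0,1\}^n:\mathcal{R}(\mathbf{x})\ne\emptyset\}$. The uncertainty set is $\mathcal{U}^{\mathcal{HP}}=\{\underline{\mathbf{c}}+\boldsymbol{\delta}:\mathbf{A}\boldsymbol{\delta}\le\mathbf{b},\boldsymbol{\delta}\ge\mathbf{0}\}\subset\mathbb{R}^n_+$, bounded. For $\mathbf{x}\in\mathcal{X}'$, $\textsc{Eval}(\mathbf{x})=\mathbf{C}^T\mathbf{x}+\max_{\mathbf{c}\in\mathcal{U}^{\mathcal{HP}}}\min_{\mathbf{y}\in\mathcal{R}(\mathbf{x})}\mathbf{c}^T\mathbf{y}$, and the robust two-stage problem is $\min_{\mathbf{x}\in\mathcal{X}'}\textsc{Eval}(\mathbf{x})$.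
   Formalization: The data H, g, C, A, b and $\underline{\mathbf{c}}$, the vector u, the deviations $\boldsymbol{\delta}$ and the variables of the LP relaxation are rational rather than real. -}

module Defs where

open import Data.Nat using (ℕ; zero; suc)
open import Data.Fin using (Fin; zero; suc)
open import Data.Rational using (ℚ; 0ℚ; 1ℚ; _+_; _*_; _≤_)
open import Data.Product using (Σ; ∃; _×_; _,_)
open import Data.Sum using (_⊎_)
open import Relation.Binary.PropositionalEquality using (_≡_)

Vecℚ : ℕ → Set
Vecℚ n = Fin n → ℚ

Matℚ : ℕ → ℕ → Set
Matℚ m n = Fin m → Fin n → ℚ

sumℚ : ∀ {n} → (Fin n → ℚ) → ℚ
sumℚ {zero}  f = 0ℚ
sumℚ {suc n} f = f zero + sumℚ (λ i → f (suc i))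

dot : ∀ {n} → Vecℚ n → Vecℚ n → ℚ
dot a b = sumℚ (λ i → a i * b i)

mulMV : ∀ {m n} → Matℚ m n → Vecℚ n → Vecℚ m
mulMV M v i = dot (M i) v

mulVM : ∀ {m n} → Vecℚ m → Matℚ m n → Vecℚ n
mulVM u M j = sumℚ (λ i → u i * M i j)

_+v_ : ∀ {n} → Vecℚ n → Vecℚ n → Vecℚ n
(a +v b) i = a i + b i

_≤v_ : ∀ {n} → Vecℚ n → Vecℚ n → Set
a ≤v b = ∀ i → a i ≤ b i

𝟎 : ∀ {n} → Vecℚ n
𝟎 _ = 0ℚ

𝟏 : ∀ {n} → Vecℚ n
𝟏 _ = 1ℚ

Binary : ∀ {n} → Vecℚ n → Set
Binary x = ∀ i → (x i ≡ 0ℚ) ⊎ (x i ≡ 1ℚ)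

In𝒳 : ∀ {m n} → Matℚ m n → Vecℚ m → Vecℚ n → Set
In𝒳 H g x = Binary x × (g ≤v mulMV H x)

Inℛ : ∀ {m n} → Matℚ m n → Vecℚ m → Vecℚ n → Vecℚ n → Set
Inℛ H g x y = Binary y × In𝒳 H g (x +v y)

In𝒳' : ∀ {m n} → Matℚ m n → Vecℚ m → Vecℚ n → Set
In𝒳' H g x = Binary x × ∃ (λ y → Inℛ H g x y)

In𝒰 : ∀ {k n} → Matℚ k n → Vecℚ k → Vecℚ n → Vecℚ n → Set
In𝒰 A b cl c = ∃ λ δ → (mulMV A δ ≤v b) × (𝟎 ≤v δ) × (∀ i → c i ≡ cl i + δ i)

-- "v = max_{c ∈ 𝒰} min_{y ∈ ℛ(x)} c^T y"  (max and min attained)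
IsWorstCase : ∀ {m n k} → Matℚ m n → Vecℚ m → Matℚ k n → Vecℚ k → Vecℚ n →
              Vecℚ n → ℚ → Set
IsWorstCase H g A b cl x v =
  (∀ c → In𝒰 A b cl c → ∃ λ y → Inℛ H g x y × (dot c y ≤ v)) ×
  (∃ λ c → In𝒰 A b cl c × (∀ y → Inℛ H g x y → v ≤ dot c y))

IsEval : ∀ {m n k} → Matℚ m n → Vecℚ m → Matℚ k n → Vecℚ k → Vecℚ n →
         Vecℚ n → Vecℚ n → ℚ → Set
IsEval H g A b cl C x e = ∃ λ v → IsWorstCase H g A b cl x v × (e ≡ dot C x + v)

IsOptEval : ∀ {m n k} → Matℚ m n → Vecℚ m → Matℚ k n → Vecℚ k → Vecℚ n →
            Vecℚ n → ℚ → Set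
IsOptEval H g A b cl C opt =
  (∃ λ x → In𝒳' H g x × IsEval H g A b cl C x opt) ×
  (∀ x e → In𝒳' H g x → IsEval H g A b cl C x e → opt ≤ e)

CommonCons : ∀ {m n k} → Matℚ m n → Vecℚ m → Matℚ k n →
             Vecℚ n → Vecℚ n → Vecℚ k → Set
CommonCons H g A x y u =
  (g ≤v mulMV H (y +v x)) × ((x +v y) ≤v 𝟏) × (y ≤v mulVM u A) × (𝟎 ≤v u)

FeasMIP : ∀ {m n k} → Matℚ m n → Vecℚ m → Matℚ k n →
          Vecℚ n → Vecℚ n → Vecℚ k → Set
FeasMIP H g A x y u = CommonCons H g A x y u × Binary x × Binary y

FeasLP : ∀ {m n k} → Matℚ m n → Vecℚ m → Matℚ k n →
         Vecℚ n → Vecℚ n → Vecℚ k → Set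
FeasLP H g A x y u = CommonCons H g A x y u ×
  (𝟎 ≤v x) × (x ≤v 𝟏) × (𝟎 ≤v y) × (y ≤v 𝟏)

objMIP : ∀ {n k} → Vecℚ k → Vecℚ n → Vecℚ n → Vecℚ n → Vecℚ n → Vecℚ k → ℚ
objMIP b cl C x y u = dot C x + dot cl y + dot u b

IsOptMIP : ∀ {m n k} → Matℚ m n → Vecℚ m → Matℚ k n → Vecℚ k → Vecℚ n →
           Vecℚ n → Vecℚ n → Vecℚ n → Vecℚ k → Set
IsOptMIP H g A b cl C x y u =
  FeasMIP H g A x y u ×
  (∀ x' y' u' → FeasMIP H g A x' y' u' → objMIP b cl C x y u ≤ objMIP b cl C x' y' u')

IsOptValLP : ∀ {m n k} → Matℚ m n → Vecℚ m → Matℚ k n → Vecℚ k → Vecℚ n →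
             Vecℚ n → ℚ → Set
IsOptValLP H g A b cl C z =
  (∃ λ x → ∃ λ y → ∃ λ u → FeasLP H g A x y u × (objMIP b cl C x y u ≡ z)) ×
  (∀ x y u → FeasLP H g A x y u → z ≤ objMIP b cl C x y u)

{-# OPTIONS --safe #-}

-- The recourse ys is admissible for xs, and by weak LP duality u·b bounds δ·ys for every deviation
-- δ of 𝒰, so Eval(xs) ≤ obj(xs, ys, us). Conversely, let Eval(x₀) = C·x₀ + v. If every LP point
-- (x₀, y, u) cost more, the system "LP constraints at x₀ and c̲·y + b·u ≤ v" in (y, u) would be
-- infeasible, and Farkas' lemma (proved constructively by Fourier–Motzkin elimination) would give
-- multipliers whose weights δ on the rows y ≤ uᵀA satisfy Aδ ≤ κ b, κ being the weight of the cost
-- row. Mixing δ with a scenario of 𝒰 gives a scenario in which every recourse costs more than v,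
-- contradicting the choice of v. Hence z_LP ≤ min Eval, and
-- Eval(xs) ≤ obj = (obj / z_LP) · z_LP ≤ (obj / z_LP) · min Eval.

module Submission where

open import Defs
open import Data.Nat using (ℕ; zero; suc)
open import Data.Fin using (Fin; zero; suc)
open import Data.Rational using (ℚ; 0ℚ; 1ℚ; _+_; _*_; _-_; -_; _⊔_; _÷_; 1/_; _≤_; _<_; _≤?_; NonZero; positive; nonNegative)
open import Data.Rational.Properties
open import Data.Product using (Σ; ∃; _×_; _,_; proj₁; proj₂)
open import Data.Sum using (_⊎_; inj₁; inj₂; [_,_])
open import Data.Empty using (⊥-elim)
open import Data.List using (List; []; _∷_; _++_; map; allFin)
open import Data.List.Membership.Propositional using (_∈_)
open import Data.List.Membership.Propositional.Properties using (∈-map⁺; ∈-++⁺ˡ; ∈-++⁺ʳ; ∈-allFin)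
open import Data.List.Relation.Unary.Any using (here; there; satisfied)
open import Data.List.Relation.Unary.All as All using (All; []; _∷_)
open import Data.List.Relation.Unary.All.Properties using (map⁺; map⁻; ++⁻; ¬All⇒Any¬)
open import Algebra.Bundles using (CommutativeRing)
open import Function using (_∘′_)
open import Relation.Binary.Bundles using (DecTotalOrder)
open import Relation.Binary.Definitions using (tri<; tri≈; tri>)
open import Relation.Binary.PropositionalEquality using (_≡_; refl; sym; trans; cong; cong₂; subst; subst₂; module ≡-Reasoning)
open import Relation.Nullary using (¬_)
open import Relation.Nullary.Decidable.Core using (dec⇒maybe)
open import Tactic.RingSolver using (solve-∀)
open import Tactic.RingSolver.Core.AlmostCommutativeRing using (AlmostCommutativeRing; fromCommutativeRing)
import Algebra.Properties.Semiring.Sum (CommutativeRing.semiring +-*-commutativeRing) as Sum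
import Data.List.Extrema (DecTotalOrder.totalOrder ≤-decTotalOrder) as Extrema

ℚ-ring : AlmostCommutativeRing _ _
ℚ-ring = fromCommutativeRing +-*-commutativeRing (λ x → dec⇒maybe (0ℚ ≟ x))

*-monoˡ-≤-0≤ : ∀ {c p q} → 0ℚ ≤ c → p ≤ q → c * p ≤ c * q
*-monoˡ-≤-0≤ {c} 0≤c = *-monoˡ-≤-nonNeg c {{nonNegative 0≤c}}

0≤+0≤ : ∀ {p q} → 0ℚ ≤ p → 0ℚ ≤ q → 0ℚ ≤ p + q
0≤+0≤ = +-mono-≤

0≤*0≤ : ∀ {p q} → 0ℚ ≤ p → 0ℚ ≤ q → 0ℚ ≤ p * q
0≤*0≤ {p} {q} 0≤p 0≤q = nonNegative⁻¹ _ {{nonNeg*nonNeg⇒nonNeg p {{nonNegative 0≤p}} q {{nonNegative 0≤q}}}}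

≤-translate : ∀ t {p q p′ q′} → p + t ≡ p′ → q + t ≡ q′ → p ≤ q → p′ ≤ q′
≤-translate t refl refl p≤q = +-monoˡ-≤ t p≤q

0≤1 : 0ℚ ≤ 1ℚ
0≤1 = nonNegative⁻¹ 1ℚ

0<1 : 0ℚ < 1ℚ
0<1 = positive⁻¹ 1ℚ

positive-inverse : ∀ c → 0ℚ < c → Σ ℚ λ k → 0ℚ < k × k * c ≡ 1ℚ
positive-inverse c 0<c = (1/ c) {{c≢0}} , positive⁻¹ _ {{1/pos⇒pos c {{positive 0<c}}}} , *-inverseˡ c {{c≢0}}
  where
  c≢0 : NonZero c
  c≢0 = pos⇒nonZero c {{positive 0<c}}

-p≤0⇒0≤p : ∀ p → - p ≤ 0ℚ → 0ℚ ≤ p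
-p≤0⇒0≤p p = ≤-translate p (+-inverseˡ p) (+-identityˡ p)

0≤p⇒-p≤0 : ∀ p → 0ℚ ≤ p → - p ≤ 0ℚ
0≤p⇒-p≤0 p = neg-antimono-≤

p-q≤0⇒p≤q : ∀ p q → p - q ≤ 0ℚ → p ≤ q
p-q≤0⇒p≤q p q = ≤-translate q (cancel p q) (+-identityˡ q)
  where
  cancel : ∀ p q → p - q + q ≡ p
  cancel = solve-∀ ℚ-ring

p≤r-q⇒q+p≤r : ∀ p q r → p ≤ r - q → q + p ≤ r
p≤r-q⇒q+p≤r p q r = ≤-translate q (+-comm p q) (cancel r q)
  where
  cancel : ∀ r q → r - q + q ≡ r
  cancel = solve-∀ ℚ-ring

q+p≤r⇒p≤r-q : ∀ p q r → q + p ≤ r → p ≤ r - q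
q+p≤r⇒p≤r-q p q r = ≤-translate (- q) (cancel q p) refl
  where
  cancel : ∀ q p → q + p - q ≡ p
  cancel = solve-∀ ℚ-ring

-a≤c-g⇒g≤c+a : ∀ a c g → - a ≤ c - g → g ≤ c + a
-a≤c-g⇒g≤c+a a c g = ≤-translate (g + a) (cancel a g) (rearrange a c g)
  where
  cancel : ∀ a g → - a + (g + a) ≡ g
  cancel = solve-∀ ℚ-ring
  rearrange : ∀ a c g → c - g + (g + a) ≡ c + a
  rearrange = solve-∀ ℚ-ring

g≤c+a⇒-a≤c-g : ∀ a c g → g ≤ c + a → - a ≤ c - g
g≤c+a⇒-a≤c-g a c g = ≤-translate (- a - g) (cancel a g) (rearrange a c g)
  where
  cancel : ∀ a g → g + (- a - g) ≡ - a
  cancel = solve-∀ ℚ-ring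
  rearrange : ∀ a c g → c + a + (- a - g) ≡ c - g
  rearrange = solve-∀ ℚ-ring

pair-limits : ∀ p q r r′ → p + q ≤ r + r′ → q - r′ ≤ r - p
pair-limits p q r r′ = ≤-translate (- p - r′) (left p q r′) (right p r r′)
  where
  left : ∀ p q r′ → p + q + (- p - r′) ≡ q - r′
  left = solve-∀ ℚ-ring
  right : ∀ p r r′ → r + r′ + (- p - r′) ≡ r - p
  right = solve-∀ ℚ-ring

below-upper-limit : ∀ p r w → w ≤ r - p → p + 1ℚ * w ≤ r
below-upper-limit p r w = ≤-translate p (left p w) (right p r)
  where
  left : ∀ p w → w + p ≡ p + 1ℚ * w
  left = solve-∀ ℚ-ring
  right : ∀ p r → r - p + p ≡ r
  right = solve-∀ ℚ-ring

above-lower-limit : ∀ q r w → q - r ≤ w → q + (- 1ℚ) * w ≤ r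
above-lower-limit q r w = ≤-translate (r - w) (left q r w) (right r w)
  where
  left : ∀ q r w → q - r + (r - w) ≡ q + (- 1ℚ) * w
  left = solve-∀ ℚ-ring
  right : ∀ r w → w + (r - w) ≡ r
  right = solve-∀ ℚ-ring

+-cancelˡ-< : ∀ p q r → p + q < p + r → q < r
+-cancelˡ-< p q r = subst₂ _<_ (cancel p q) (cancel p r) ∘′ +-monoˡ-< (- p)
  where
  cancel : ∀ p q → p + q + - p ≡ q
  cancel = solve-∀ ℚ-ring

≤-÷-* : ∀ {z a e o} .{{_ : NonZero z}} → 0ℚ < z → z ≤ a → e ≤ a → z ≤ o → e ≤ (a ÷ z) * o
≤-÷-* {z} {a} {e} {o} 0<z z≤a e≤a z≤o = begin
  e                ≤⟨ e≤a ⟩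
  a                ≡⟨ sym (trans (*-assoc a (1/ z) z) (trans (cong (a *_) (*-inverseˡ z)) (*-identityʳ a))) ⟩
  (a ÷ z) * z      ≤⟨ *-monoˡ-≤-0≤ 0≤a÷z z≤o ⟩
  (a ÷ z) * o      ∎
  where
  open ≤-Reasoning
  0≤a÷z : 0ℚ ≤ a ÷ z
  0≤a÷z = 0≤*0≤ (≤-trans (<⇒≤ 0<z) z≤a) (<⇒≤ (positive⁻¹ _ {{1/pos⇒pos z {{positive 0<z}}}}))

choose-scale : ∀ κ P v → 0ℚ ≤ κ → P + κ * v < 0ℚ → ∃ λ T → 0ℚ ≤ T × κ * T ≤ 1ℚ × v < T * - P
choose-scale κ P v 0≤κ P+κv<0 with <-cmp 0ℚ κ
... | tri> _ _ κ<0 = ⊥-elim (<-irrefl refl (<-≤-trans κ<0 0≤κ))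
... | tri< 0<κ _ _ =
  let (k , 0<k , kκ≡1) = positive-inverse κ 0<κ in
  k , <⇒≤ 0<k , ≤-reflexive (trans (*-comm κ k) kκ≡1) ,
  subst (_< k * - P) (trans (sym (*-assoc k κ v)) (trans (cong (_* v) kκ≡1) (*-identityˡ v)))
        (*-monoʳ-<-pos k {{positive 0<k}} κv<-P)
  where
  cancel : ∀ P x → P + x + - P ≡ x
  cancel = solve-∀ ℚ-ring
  κv<-P : κ * v < - P
  κv<-P = subst₂ _<_ (cancel P (κ * v)) (+-identityˡ (- P)) (+-monoˡ-< (- P) P+κv<0)
... | tri≈ _ refl _ =
  let (k , 0<k , k[-P]≡1) = positive-inverse (- P) (neg-antimono-< P<0) in
  w * k , 0≤*0≤ 0≤w (<⇒≤ 0<k) , ≤-trans (≤-reflexive (*-zeroˡ (w * k))) 0≤1 ,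
  subst (v <_) (sym (trans (*-assoc w k (- P)) (trans (cong (w *_) k[-P]≡1) (*-identityʳ w)))) v<w
  where
  w : ℚ
  w = v ⊔ 0ℚ + 1ℚ
  P<0 : P < 0ℚ
  P<0 = subst (_< 0ℚ) (trans (cong (P +_) (*-zeroˡ v)) (+-identityʳ P)) P+κv<0
  v⊔0<w : v ⊔ 0ℚ < w
  v⊔0<w = subst (_< w) (+-identityʳ (v ⊔ 0ℚ)) (+-monoʳ-< (v ⊔ 0ℚ) 0<1)
  0≤w : 0ℚ ≤ w
  0≤w = <⇒≤ (≤-<-trans (p≤q⊔p v 0ℚ) v⊔0<w)
  v<w : v < w
  v<w = ≤-<-trans (p≤p⊔q v 0ℚ) v⊔0<w

sumℚ≡sum : ∀ {n} (f : Fin n → ℚ) → sumℚ f ≡ Sum.sum f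
sumℚ≡sum {zero}  f = refl
sumℚ≡sum {suc n} f = cong (f zero +_) (sumℚ≡sum (λ i → f (suc i)))

sumℚ-cong : ∀ {n} {f g : Fin n → ℚ} → (∀ i → f i ≡ g i) → sumℚ f ≡ sumℚ g
sumℚ-cong {f = f} {g} f≗g
  rewrite sumℚ≡sum f | sumℚ≡sum g = Sum.sum-cong-≗ f≗g

sumℚ-+ : ∀ {n} (f g : Fin n → ℚ) → sumℚ (λ i → f i + g i) ≡ sumℚ f + sumℚ g
sumℚ-+ f g
  rewrite sumℚ≡sum (λ i → f i + g i) | sumℚ≡sum f | sumℚ≡sum g = Sum.∑-distrib-+ f g

sumℚ-*ˡ : ∀ {n} c (f : Fin n → ℚ) → sumℚ (λ i → c * f i) ≡ c * sumℚ f
sumℚ-*ˡ c f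
  rewrite sumℚ≡sum (λ i → c * f i) | sumℚ≡sum f = sym (Sum.*-distribˡ-sum c f)

sumℚ-comm : ∀ {m n} (f : Fin m → Fin n → ℚ) →
            sumℚ (λ i → sumℚ (f i)) ≡ sumℚ (λ j → sumℚ (λ i → f i j))
sumℚ-comm {m} {n} f = begin
  sumℚ (λ i → sumℚ (f i))              ≡⟨ sumℚ-cong (λ i → sumℚ≡sum (f i)) ⟩
  sumℚ (λ i → Sum.sum (f i))           ≡⟨ sumℚ≡sum (λ i → Sum.sum (f i)) ⟩
  Sum.sum (λ i → Sum.sum (f i))        ≡⟨ Sum.∑-comm f ⟩
  Sum.sum (λ j → Sum.sum (λ i → f i j)) ≡⟨ sym (sumℚ≡sum (λ j → Sum.sum (λ i → f i j))) ⟩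
  sumℚ (λ j → Sum.sum (λ i → f i j))   ≡⟨ sym (sumℚ-cong (λ j → sumℚ≡sum (λ i → f i j))) ⟩
  sumℚ (λ j → sumℚ (λ i → f i j))      ∎
  where open ≡-Reasoning

sumℚ-zero : ∀ n → sumℚ {n} (λ _ → 0ℚ) ≡ 0ℚ
sumℚ-zero n = trans (sumℚ≡sum {n} (λ _ → 0ℚ)) (Sum.sum-replicate-zero n)

sumℚ-mono : ∀ {n} {f g : Fin n → ℚ} → (∀ i → f i ≤ g i) → sumℚ f ≤ sumℚ g
sumℚ-mono {zero}  f≤g = ≤-refl
sumℚ-mono {suc n} f≤g = +-mono-≤ (f≤g zero) (sumℚ-mono (λ i → f≤g (suc i)))

sumℚ-linear : ∀ {n} p q (f h : Vecℚ n) → sumℚ (λ j → p * f j + q * h j) ≡ p * sumℚ f + q * sumℚ h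
sumℚ-linear p q f h = trans (sumℚ-+ (λ j → p * f j) (λ j → q * h j)) (cong₂ _+_ (sumℚ-*ˡ p f) (sumℚ-*ˡ q h))

indicator : ∀ {n} → Fin n → Fin n → ℚ
indicator zero    zero    = 1ℚ
indicator zero    (suc j) = 0ℚ
indicator (suc i) zero    = 0ℚ
indicator (suc i) (suc j) = indicator i j

indicator-nonneg : ∀ {n} (i j : Fin n) → 0ℚ ≤ indicator i j
indicator-nonneg zero    zero    = 0≤1
indicator-nonneg zero    (suc j) = ≤-refl
indicator-nonneg (suc i) zero    = ≤-refl
indicator-nonneg (suc i) (suc j) = indicator-nonneg i j

sumℚ-indicator : ∀ {n} (i : Fin n) (f : Fin n → ℚ) → sumℚ (λ j → indicator i j * f j) ≡ f i
sumℚ-indicator {suc n} zero f = begin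
  1ℚ * f zero + sumℚ (λ j → 0ℚ * f (suc j)) ≡⟨ cong₂ _+_ (*-identityˡ (f zero))
                                                          (sumℚ-cong (λ j → *-zeroˡ (f (suc j)))) ⟩
  f zero + sumℚ {n} (λ _ → 0ℚ)             ≡⟨ cong (f zero +_) (sumℚ-zero n) ⟩
  f zero + 0ℚ                              ≡⟨ +-identityʳ (f zero) ⟩
  f zero                                   ∎
  where open ≡-Reasoning
sumℚ-indicator (suc i) f = trans (cong (_+ sumℚ (λ j → indicator i j * f (suc j))) (*-zeroˡ (f zero)))
  (trans (+-identityˡ _) (sumℚ-indicator i (λ j → f (suc j))))

-- Index sets built from Fin by disjoint union, so that the rows and the variables of a linear
-- system can be addressed blockwise.
data Shape : Set where
  fin : ℕ → Shape
  _⊕_ : Shape → Shape → Shape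

Index : Shape → Set
Index (fin n) = Fin n
Index (s ⊕ t) = Index s ⊎ Index t

∑ : (s : Shape) → (Index s → ℚ) → ℚ
∑ (fin n) f = sumℚ f
∑ (s ⊕ t) f = ∑ s (λ i → f (inj₁ i)) + ∑ t (λ j → f (inj₂ j))

∑-cong : ∀ s {f g : Index s → ℚ} → (∀ i → f i ≡ g i) → ∑ s f ≡ ∑ s g
∑-cong (fin n) f≗g = sumℚ-cong f≗g
∑-cong (s ⊕ t) f≗g = cong₂ _+_ (∑-cong s (λ i → f≗g (inj₁ i))) (∑-cong t (λ j → f≗g (inj₂ j)))

∑-+ : ∀ s (f g : Index s → ℚ) → ∑ s (λ i → f i + g i) ≡ ∑ s f + ∑ s g
∑-+ (fin n) f g = sumℚ-+ f g
∑-+ (s ⊕ t) f g = trans (cong₂ _+_ (∑-+ s f₁ g₁) (∑-+ t f₂ g₂))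
                        (+-interchange (∑ s f₁) (∑ s g₁) (∑ t f₂) (∑ t g₂))
  where
  f₁ g₁ : Index s → ℚ
  f₁ i = f (inj₁ i)
  g₁ i = g (inj₁ i)
  f₂ g₂ : Index t → ℚ
  f₂ j = f (inj₂ j)
  g₂ j = g (inj₂ j)
  +-interchange : ∀ a b c d → a + b + (c + d) ≡ a + c + (b + d)
  +-interchange = solve-∀ ℚ-ring

∑-*ˡ : ∀ s c (f : Index s → ℚ) → ∑ s (λ i → c * f i) ≡ c * ∑ s f
∑-*ˡ (fin n) c f = sumℚ-*ˡ c f
∑-*ˡ (s ⊕ t) c f = trans (cong₂ _+_ (∑-*ˡ s c _) (∑-*ˡ t c _)) (sym (*-distribˡ-+ c _ _))

∑-zero : ∀ s → ∑ s (λ _ → 0ℚ) ≡ 0ℚ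
∑-zero (fin n) = sumℚ-zero n
∑-zero (s ⊕ t) = trans (cong₂ _+_ (∑-zero s) (∑-zero t)) (+-identityʳ 0ℚ)

∑-mono : ∀ s {f g : Index s → ℚ} → (∀ i → f i ≤ g i) → ∑ s f ≤ ∑ s g
∑-mono (fin n) f≤g = sumℚ-mono f≤g
∑-mono (s ⊕ t) f≤g = +-mono-≤ (∑-mono s (λ i → f≤g (inj₁ i))) (∑-mono t (λ j → f≤g (inj₂ j)))

∑-comm : ∀ s t (f : Index s → Index t → ℚ) →
         ∑ s (λ i → ∑ t (f i)) ≡ ∑ t (λ j → ∑ s (λ i → f i j))
∑-comm (fin m) (fin n) f = sumℚ-comm f
∑-comm (fin m) (t ⊕ u) f = trans (∑-+ (fin m) _ _)
  (cong₂ _+_ (∑-comm (fin m) t (λ i j → f i (inj₁ j))) (∑-comm (fin m) u (λ i j → f i (inj₂ j))))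
∑-comm (s ⊕ s′) t f = trans
  (cong₂ _+_ (∑-comm s t (λ i → f (inj₁ i))) (∑-comm s′ t (λ i → f (inj₂ i))))
  (sym (∑-+ t _ _))

basis : ∀ s → Index s → Index s → ℚ
basis (fin n) i j = indicator i j
basis (s ⊕ t) (inj₁ i) (inj₁ j) = basis s i j
basis (s ⊕ t) (inj₁ i) (inj₂ j) = 0ℚ
basis (s ⊕ t) (inj₂ i) (inj₁ j) = 0ℚ
basis (s ⊕ t) (inj₂ i) (inj₂ j) = basis t i j

basis-nonneg : ∀ s (i j : Index s) → 0ℚ ≤ basis s i j
basis-nonneg (fin n) i j = indicator-nonneg i j
basis-nonneg (s ⊕ t) (inj₁ i) (inj₁ j) = basis-nonneg s i j
basis-nonneg (s ⊕ t) (inj₁ i) (inj₂ j) = ≤-refl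
basis-nonneg (s ⊕ t) (inj₂ i) (inj₁ j) = ≤-refl
basis-nonneg (s ⊕ t) (inj₂ i) (inj₂ j) = basis-nonneg t i j

∑-zeroˡ-* : ∀ s (f : Index s → ℚ) → ∑ s (λ i → 0ℚ * f i) ≡ 0ℚ
∑-zeroˡ-* s f = trans (∑-cong s (λ i → *-zeroˡ (f i))) (∑-zero s)

∑-basis : ∀ s i (f : Index s → ℚ) → ∑ s (λ j → basis s i j * f j) ≡ f i
∑-basis (fin n) i f = sumℚ-indicator i f
∑-basis (s ⊕ t) (inj₁ i) f = trans
  (cong₂ _+_ (∑-basis s i (λ j → f (inj₁ j))) (∑-zeroˡ-* t (λ j → f (inj₂ j))))
  (+-identityʳ (f (inj₁ i)))
∑-basis (s ⊕ t) (inj₂ i) f = trans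
  (cong₂ _+_ (∑-zeroˡ-* s (λ j → f (inj₁ j))) (∑-basis t i (λ j → f (inj₂ j))))
  (+-identityˡ (f (inj₂ i)))

allIndices : ∀ s → List (Index s)
allIndices (fin n) = allFin n
allIndices (s ⊕ t) = map inj₁ (allIndices s) ++ map inj₂ (allIndices t)

∈-allIndices : ∀ s (i : Index s) → i ∈ allIndices s
∈-allIndices (fin n) i = ∈-allFin i
∈-allIndices (s ⊕ t) (inj₁ i) = ∈-++⁺ˡ (∈-map⁺ inj₁ (∈-allIndices s i))
∈-allIndices (s ⊕ t) (inj₂ j) = ∈-++⁺ʳ (map inj₁ (allIndices s)) (∈-map⁺ inj₂ (∈-allIndices t j))

inner : ∀ s → (Index s → ℚ) → (Index s → ℚ) → ℚ
inner s a z = ∑ s (λ j → a j * z j)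

∑-*ʳ : ∀ s (f : Index s → ℚ) c → ∑ s (λ i → f i * c) ≡ ∑ s f * c
∑-*ʳ s f c = trans (∑-cong s (λ i → *-comm (f i) c)) (trans (∑-*ˡ s c f) (*-comm c (∑ s f)))

∑-inner : ∀ s t (w : Index t → ℚ) (a : Index t → Index s → ℚ) z →
          ∑ t (λ i → w i * inner s (a i) z) ≡ inner s (λ j → ∑ t (λ i → w i * a i j)) z
∑-inner s t w a z = begin
  ∑ t (λ i → w i * ∑ s (λ j → a i j * z j))    ≡⟨ ∑-cong t (λ i → sym (∑-*ˡ s (w i) (λ j → a i j * z j))) ⟩
  ∑ t (λ i → ∑ s (λ j → w i * (a i j * z j)))  ≡⟨ ∑-comm t s (λ i j → w i * (a i j * z j)) ⟩
  ∑ s (λ j → ∑ t (λ i → w i * (a i j * z j)))  ≡⟨ ∑-cong s (λ j →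
                                                      trans (∑-cong t (λ i → sym (*-assoc (w i) (a i j) (z j))))
                                                            (∑-*ʳ t (λ i → w i * a i j) (z j))) ⟩
  ∑ s (λ j → ∑ t (λ i → w i * a i j) * z j)    ∎
  where open ≡-Reasoning

inner-+ : ∀ s (a a′ z : Index s → ℚ) → inner s (λ j → a j + a′ j) z ≡ inner s a z + inner s a′ z
inner-+ s a a′ z = trans (∑-cong s (λ j → *-distribʳ-+ (z j) (a j) (a′ j))) (∑-+ s _ _)

inner-*ˡ : ∀ s c (a z : Index s → ℚ) → inner s (λ j → c * a j) z ≡ c * inner s a z
inner-*ˡ s c a z = trans (∑-cong s (λ j → *-assoc c (a j) (z j))) (∑-*ˡ s c _)

inner-zeroʳ : ∀ s (a : Index s → ℚ) → inner s a (λ _ → 0ℚ) ≡ 0ℚ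
inner-zeroʳ s a = trans (∑-cong s (λ j → *-zeroʳ (a j))) (∑-zero s)

inner-basis-shift : ∀ s (a z : Index s → ℚ) x w →
                    inner s a (λ j → z j + basis s x j * w) ≡ inner s a z + a x * w
inner-basis-shift s a z x w = begin
  ∑ s (λ j → a j * (z j + basis s x j * w))           ≡⟨ ∑-cong s (λ j → distribute (a j) (z j) (basis s x j) w) ⟩
  ∑ s (λ j → a j * z j + basis s x j * (a j * w))     ≡⟨ ∑-+ s (λ j → a j * z j) (λ j → basis s x j * (a j * w)) ⟩
  inner s a z + ∑ s (λ j → basis s x j * (a j * w))   ≡⟨ cong (inner s a z +_) (∑-basis s x (λ j → a j * w)) ⟩
  inner s a z + a x * w                               ∎
  where
  open ≡-Reasoning
  distribute : ∀ a z e w → a * (z + e * w) ≡ a * z + e * (a * w)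
  distribute = solve-∀ ℚ-ring

∑-distribʳ-+ : ∀ t (w w′ c : Index t → ℚ) →
               ∑ t (λ i → (w i + w′ i) * c i) ≡ ∑ t (λ i → w i * c i) + ∑ t (λ i → w′ i * c i)
∑-distribʳ-+ t w w′ c = trans (∑-cong t (λ i → *-distribʳ-+ (c i) (w i) (w′ i))) (∑-+ t _ _)

∑-*-assoc : ∀ t k (w c : Index t → ℚ) → ∑ t (λ i → (k * w i) * c i) ≡ k * ∑ t (λ i → w i * c i)
∑-*-assoc t k w c = trans (∑-cong t (λ i → *-assoc k (w i) (c i))) (∑-*ˡ t k _)

-- Farkas' lemma by Fourier–Motzkin elimination

record Certificate {s t : Shape} (a : Index t → Index s → ℚ) (β : Index t → ℚ) : Set where
  field
    weight        : Index t → ℚ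
    weight-nonneg : ∀ i → 0ℚ ≤ weight i
    cancels       : ∀ j → ∑ t (λ i → weight i * a i j) ≡ 0ℚ
    negative      : ∑ t (λ i → weight i * β i) < 0ℚ

  weighted-bound : ∀ (z : Index s → ℚ) (G : Index t → ℚ) →
                   (∀ i → inner s (a i) z ≤ G i) → 0ℚ ≤ ∑ t (λ i → weight i * G i)
  weighted-bound z G az≤G = begin
    0ℚ                                             ≡⟨ sym (∑-zeroˡ-* s z) ⟩
    inner s (λ _ → 0ℚ) z                           ≡⟨ sym (∑-cong s (λ j → cong (_* z j) (cancels j))) ⟩
    inner s (λ j → ∑ t (λ i → weight i * a i j)) z ≡⟨ sym (∑-inner s t weight a z) ⟩
    ∑ t (λ i → weight i * inner s (a i) z)         ≤⟨ ∑-mono t (λ i → *-monoˡ-≤-0≤ (weight-nonneg i) (az≤G i)) ⟩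
    ∑ t (λ i → weight i * G i)                     ∎
    where open ≤-Reasoning

module FourierMotzkin {s t : Shape} (a : Index t → Index s → ℚ) (β : Index t → ℚ) where

  -- A derived inequality keeps its weights: once every variable is eliminated they form the
  -- certificate.
  record Derived (Vs : List (Index s)) : Set where
    field
      coef          : Index s → ℚ
      rhs           : ℚ
      weight        : Index t → ℚ
      weight-nonneg : ∀ i → 0ℚ ≤ weight i
      coef-≡        : ∀ j → coef j ≡ ∑ t (λ i → weight i * a i j)
      rhs-≡         : rhs ≡ ∑ t (λ i → weight i * β i)
      supported     : ∀ j → coef j ≡ 0ℚ ⊎ j ∈ Vs
  open Derived

  _⊨_ : ∀ {Vs} → (Index s → ℚ) → Derived Vs → Set
  z ⊨ r = inner s (coef r) z ≤ rhs r

  row : Index t → Derived (allIndices s)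
  row i = record
    { coef          = a i
    ; rhs           = β i
    ; weight        = basis t i
    ; weight-nonneg = basis-nonneg t i
    ; coef-≡        = λ j → sym (∑-basis t i (λ i′ → a i′ j))
    ; rhs-≡         = sym (∑-basis t i β)
    ; supported     = λ j → inj₂ (∈-allIndices s j)
    }

  _⊞_ : ∀ {Vs} → Derived Vs → Derived Vs → Derived Vs
  _⊞_ {Vs} r r′ = record
    { coef          = λ j → coef r j + coef r′ j
    ; rhs           = rhs r + rhs r′
    ; weight        = λ i → weight r i + weight r′ i
    ; weight-nonneg = λ i → 0≤+0≤ (weight-nonneg r i) (weight-nonneg r′ i)
    ; coef-≡        = λ j → trans (cong₂ _+_ (coef-≡ r j) (coef-≡ r′ j))
                                  (sym (∑-distribʳ-+ t (weight r) (weight r′) (λ i → a i j)))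
    ; rhs-≡         = trans (cong₂ _+_ (rhs-≡ r) (rhs-≡ r′)) (sym (∑-distribʳ-+ t (weight r) (weight r′) β))
    ; supported     = supported-+
    }
    where
    supported-+ : ∀ j → coef r j + coef r′ j ≡ 0ℚ ⊎ j ∈ Vs
    supported-+ j with supported r j | supported r′ j
    ... | inj₁ r₀ | inj₁ r′₀ = inj₁ (cong₂ _+_ r₀ r′₀)
    ... | inj₂ j∈ | _        = inj₂ j∈
    ... | inj₁ _  | inj₂ j∈  = inj₂ j∈

  scale : ∀ {Vs} k → 0ℚ ≤ k → Derived Vs → Derived Vs
  scale {Vs} k 0≤k r = record
    { coef          = λ j → k * coef r j
    ; rhs           = k * rhs r
    ; weight        = λ i → k * weight r i
    ; weight-nonneg = λ i → 0≤*0≤ 0≤k (weight-nonneg r i)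
    ; coef-≡        = λ j → trans (cong (k *_) (coef-≡ r j)) (sym (∑-*-assoc t k (weight r) (λ i → a i j)))
    ; rhs-≡         = trans (cong (k *_) (rhs-≡ r)) (sym (∑-*-assoc t k (weight r) β))
    ; supported     = supported-*
    }
    where
    supported-* : ∀ j → k * coef r j ≡ 0ℚ ⊎ j ∈ Vs
    supported-* j with supported r j
    ... | inj₁ r₀ = inj₁ (trans (cong (k *_) r₀) (*-zeroʳ k))
    ... | inj₂ j∈ = inj₂ j∈

  ⊨-scale⁻ : ∀ {Vs} k (0<k : 0ℚ < k) (r : Derived Vs) z → z ⊨ scale k (<⇒≤ 0<k) r → z ⊨ r
  ⊨-scale⁻ k 0<k r z = *-cancelˡ-≤-pos k {{positive 0<k}} ∘′ subst (_≤ k * rhs r) (inner-*ˡ s k (coef r) z)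

  module Elimination (x : Index s) (Vs : List (Index s)) where

    Independent Upper Lower : Set
    Independent = Σ (Derived (x ∷ Vs)) λ r → coef r x ≡ 0ℚ
    Upper       = Σ (Derived (x ∷ Vs)) λ r → coef r x ≡ 1ℚ
    Lower       = Σ (Derived (x ∷ Vs)) λ r → coef r x ≡ - 1ℚ

    drop-x : Independent → Derived Vs
    drop-x (r , r₀) = record
      { coef = coef r ; rhs = rhs r ; weight = weight r ; weight-nonneg = weight-nonneg r
      ; coef-≡ = coef-≡ r ; rhs-≡ = rhs-≡ r ; supported = supported-Vs }
      where
      supported-Vs : ∀ j → coef r j ≡ 0ℚ ⊎ j ∈ Vs
      supported-Vs j with supported r j
      ... | inj₁ rⱼ≡0        = inj₁ rⱼ≡0
      ... | inj₂ (here refl) = inj₁ r₀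
      ... | inj₂ (there j∈)  = inj₂ j∈

    normalise⁺ : (r : Derived (x ∷ Vs)) → 0ℚ < coef r x → Upper
    normalise⁺ r 0<c = let (k , 0<k , kc≡1) = positive-inverse (coef r x) 0<c in
                       scale k (<⇒≤ 0<k) r , kc≡1

    normalise⁺-sound : ∀ r 0<c z → z ⊨ proj₁ (normalise⁺ r 0<c) → z ⊨ r
    normalise⁺-sound r 0<c z = ⊨-scale⁻ _ (proj₁ (proj₂ (positive-inverse (coef r x) 0<c))) r z

    normalise⁻ : (r : Derived (x ∷ Vs)) → coef r x < 0ℚ → Lower
    normalise⁻ r c<0 = let (k , 0<k , k[-c]≡1) = positive-inverse (- coef r x) (neg-antimono-< c<0) in
                       scale k (<⇒≤ 0<k) r , trans (negate (coef r x) k) (cong -_ k[-c]≡1)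
      where
      negate : ∀ c k → k * c ≡ - (k * - c)
      negate = solve-∀ ℚ-ring

    normalise⁻-sound : ∀ r c<0 z → z ⊨ proj₁ (normalise⁻ r c<0) → z ⊨ r
    normalise⁻-sound r c<0 z = ⊨-scale⁻ _ (proj₁ (proj₂ (positive-inverse (- coef r x) (neg-antimono-< c<0)))) r z

    record Partition : Set where
      constructor ⟨_,_,_⟩
      field
        independents : List Independent
        uppers       : List Upper
        lowers       : List Lower

    classify : Derived (x ∷ Vs) → Partition → Partition
    classify r ⟨ I , U , W ⟩ with <-cmp (coef r x) 0ℚ
    ... | tri< c<0 _ _ = ⟨ I , U , normalise⁻ r c<0 ∷ W ⟩
    ... | tri≈ _ c≡0 _ = ⟨ (r , c≡0) ∷ I , U , W ⟩
    ... | tri> _ _ 0<c = ⟨ I , normalise⁺ r 0<c ∷ U , W ⟩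

    partition : List (Derived (x ∷ Vs)) → Partition
    partition []      = ⟨ [] , [] , [] ⟩
    partition (r ∷ L) = classify r (partition L)

    _⊨ₚ_ : (Index s → ℚ) → Partition → Set
    z ⊨ₚ ⟨ I , U , W ⟩ = All ((z ⊨_) ∘′ proj₁) I × All ((z ⊨_) ∘′ proj₁) U × All ((z ⊨_) ∘′ proj₁) W

    partition-sound : ∀ L z → z ⊨ₚ partition L → All (z ⊨_) L
    partition-sound []      z _ = []
    partition-sound (r ∷ L) z h with <-cmp (coef r x) 0ℚ
    partition-sound (r ∷ L) z (hI , hU , hr ∷ hW) | tri< c<0 _ _ =
      normalise⁻-sound r c<0 z hr ∷ partition-sound L z (hI , hU , hW)
    partition-sound (r ∷ L) z (hr ∷ hI , hU , hW) | tri≈ _ _ _ =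
      hr ∷ partition-sound L z (hI , hU , hW)
    partition-sound (r ∷ L) z (hI , hr ∷ hU , hW) | tri> _ _ 0<c =
      normalise⁺-sound r 0<c z hr ∷ partition-sound L z (hI , hU , hW)

    pair : Upper → Lower → Derived Vs
    pair (p , p₁) (q , q₁) = drop-x (p ⊞ q , trans (cong₂ _+_ p₁ q₁) (+-inverseʳ 1ℚ))

    pairs : List Upper → List Lower → List (Derived Vs)
    pairs []      W = []
    pairs (p ∷ U) W = map (pair p) W ++ pairs U W

    eliminate : List (Derived (x ∷ Vs)) → List (Derived Vs)
    eliminate L = map drop-x independents ++ pairs uppers lowers
      where open Partition (partition L)

    upper-limit : (Index s → ℚ) → Upper → ℚ
    upper-limit z (p , _) = rhs p - inner s (coef p) z

    lower-limit : (Index s → ℚ) → Lower → ℚ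
    lower-limit z (q , _) = inner s (coef q) z - rhs q

    pairs-limits : ∀ z U W → All (z ⊨_) (pairs U W) →
                   All (λ p → All (λ q → lower-limit z q ≤ upper-limit z p) W) U
    pairs-limits z []      W _ = []
    pairs-limits z (p ∷ U) W h with ++⁻ (map (pair p) W) h
    ... | hp , hU = All.map (λ {q} → pair-limit p q) (map⁻ hp) ∷ pairs-limits z U W hU
      where
      pair-limit : ∀ u l → z ⊨ pair u l → lower-limit z l ≤ upper-limit z u
      pair-limit (p , _) (q , _) =
        pair-limits (inner s (coef p) z) (inner s (coef q) z) (rhs p) (rhs q)
        ∘′ subst (_≤ rhs p + rhs q) (inner-+ s (coef p) (coef q) z)

    shift : (Index s → ℚ) → ℚ → Index s → ℚ
    shift z w j = z j + basis s x j * w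

    ⊨-shift : ∀ z w (r : Derived (x ∷ Vs)) → inner s (coef r) z + coef r x * w ≤ rhs r → shift z w ⊨ r
    ⊨-shift z w r = subst (_≤ rhs r) (sym (inner-basis-shift s (coef r) z x w))

    shift-independent : ∀ z w ((r , _) : Independent) → z ⊨ r → shift z w ⊨ r
    shift-independent z w (r , r₀) z⊨r = ⊨-shift z w r (subst (_≤ rhs r) (sym unchanged) z⊨r)
      where
      unchanged : inner s (coef r) z + coef r x * w ≡ inner s (coef r) z
      unchanged = trans (cong (λ c → inner s (coef r) z + c * w) r₀)
                        (trans (cong (inner s (coef r) z +_) (*-zeroˡ w)) (+-identityʳ _))

    shift-upper : ∀ z w (p : Upper) → w ≤ upper-limit z p → shift z w ⊨ proj₁ p
    shift-upper z w (p , p₁) w≤ = ⊨-shift z w p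
      (subst (λ c → inner s (coef p) z + c * w ≤ rhs p) (sym p₁) (below-upper-limit (inner s (coef p) z) (rhs p) w w≤))

    shift-lower : ∀ z w (q : Lower) → lower-limit z q ≤ w → shift z w ⊨ proj₁ q
    shift-lower z w (q , q₁) ≤w = ⊨-shift z w q
      (subst (λ c → inner s (coef q) z + c * w ≤ rhs q) (sym q₁) (above-lower-limit (inner s (coef q) z) (rhs q) w ≤w))

    -- The paired rows put every lower limit below every upper limit, so w fits between them.
    eliminate-extends : ∀ L z → All (z ⊨_) (eliminate L) → ∃ λ z′ → All (z′ ⊨_) L
    eliminate-extends L z h =
      shift z w , partition-sound L (shift z w)
        ( All.map (λ {r} → shift-independent z w r) (map⁻ (proj₁ split))
        , All.map (λ {p} → shift-upper z w p) w≤upper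
        , All.map (λ {q} → shift-lower z w q) (map⁻ (Extrema.xs≤max least-upper (map (lower-limit z) lowers))) )
      where
      open Partition (partition L)
      split : All (z ⊨_) (map drop-x independents) × All (z ⊨_) (pairs uppers lowers)
      split = ++⁻ (map drop-x independents) h
      least-upper w : ℚ
      least-upper = Extrema.min 0ℚ (map (upper-limit z) uppers)
      w = Extrema.max least-upper (map (lower-limit z) lowers)
      w≤upper : All (λ p → w ≤ upper-limit z p) uppers
      w≤upper = All.zipWith (λ (m≤ , lowers≤) → Extrema.max≤v⁺ m≤ (map⁺ lowers≤))
        (map⁻ (Extrema.min≤xs 0ℚ (map (upper-limit z) uppers)) , pairs-limits z uppers lowers (proj₂ split))

  refute : ∀ Vs (L : List (Derived Vs)) → (∀ z → ¬ All (z ⊨_) L) → ∃ λ (r : Derived []) → rhs r < 0ℚ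
  refute [] L infeasible =
    let (r , rhs≱0) = satisfied (¬All⇒Any¬ (λ r → 0ℚ ≤? rhs r) L origin-infeasible) in r , ≰⇒> rhs≱0
    where
    origin-infeasible : ¬ All (λ r → 0ℚ ≤ rhs r) L
    origin-infeasible = infeasible (λ _ → 0ℚ) ∘′ All.map (λ {r} → subst (_≤ rhs r) (sym (inner-zeroʳ s (coef r))))
  refute (x ∷ Vs) L infeasible = refute Vs (eliminate L) λ z h →
    let (z′ , h′) = eliminate-extends L z h in infeasible z′ h′
    where open Elimination x Vs

  farkas : (∀ z → ¬ (∀ i → inner s (a i) z ≤ β i)) → Certificate a β
  farkas infeasible with refute (allIndices s) (map row (allIndices t))
    (λ z h → infeasible z (λ i → All.lookup (map⁻ h) (∈-allIndices t i)))
  ... | r , rhs<0 = record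
    { weight        = weight r
    ; weight-nonneg = weight-nonneg r
    ; cancels       = λ j → trans (sym (coef-≡ r j)) (vanishes j (supported r j))
    ; negative      = subst (_< 0ℚ) (rhs-≡ r) rhs<0
    }
    where
    vanishes : ∀ j → coef r j ≡ 0ℚ ⊎ j ∈ [] → coef r j ≡ 0ℚ
    vanishes j (inj₁ rⱼ≡0) = rⱼ≡0

dot-+ʳ : ∀ {n} (a x y : Vecℚ n) → dot a (x +v y) ≡ dot a x + dot a y
dot-+ʳ a x y = trans (sumℚ-cong (λ j → *-distribˡ-+ (a j) (x j) (y j))) (sumℚ-+ (λ j → a j * x j) (λ j → a j * y j))

dot-+ˡ : ∀ {n} (a d y : Vecℚ n) → dot (a +v d) y ≡ dot a y + dot d y
dot-+ˡ a d y = trans (sumℚ-cong (λ j → *-distribʳ-+ (y j) (a j) (d j))) (sumℚ-+ (λ j → a j * y j) (λ j → d j * y j))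

dot-nonneg : ∀ {n} {a y : Vecℚ n} → 𝟎 ≤v a → 𝟎 ≤v y → 0ℚ ≤ dot a y
dot-nonneg {n} {a} {y} 0≤a 0≤y = subst (_≤ dot a y) (sumℚ-zero n) (sumℚ-mono (λ j → 0≤*0≤ (0≤a j) (0≤y j)))

dot-zeroˡ : ∀ {n} (y : Vecℚ n) → dot 𝟎 y ≡ 0ℚ
dot-zeroˡ {n} y = ∑-zeroˡ-* (fin n) y

sumℚ-neg : ∀ {n} (f y : Vecℚ n) → sumℚ (λ j → - f j * y j) ≡ - dot f y
sumℚ-neg f y = begin
  sumℚ (λ j → - f j * y j)       ≡⟨ sumℚ-cong (λ j → negate (f j) (y j)) ⟩
  sumℚ (λ j → - 1ℚ * (f j * y j)) ≡⟨ sumℚ-*ˡ (- 1ℚ) (λ j → f j * y j) ⟩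
  - 1ℚ * dot f y                 ≡⟨ sym (neg-distribˡ-* 1ℚ (dot f y)) ⟩
  - (1ℚ * dot f y)               ≡⟨ cong -_ (*-identityˡ (dot f y)) ⟩
  - dot f y                      ∎
  where
  open ≡-Reasoning
  negate : ∀ f y → - f * y ≡ - 1ℚ * (f * y)
  negate = solve-∀ ℚ-ring

dot-zeroʳ : ∀ {n} (a : Vecℚ n) → dot a 𝟎 ≡ 0ℚ
dot-zeroʳ {n} a = inner-zeroʳ (fin n) a

weak-duality : ∀ {n k} (A : Matℚ k n) (b : Vecℚ k) {u : Vecℚ k} {y δ : Vecℚ n} →
               𝟎 ≤v u → y ≤v mulVM u A → 𝟎 ≤v δ → mulMV A δ ≤v b → dot δ y ≤ dot u b
weak-duality {n} {k} A b {u} {y} {δ} 0≤u y≤uA 0≤δ Aδ≤b = begin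
  dot δ y                               ≤⟨ sumℚ-mono (λ j → *-monoˡ-≤-0≤ (0≤δ j) (y≤uA j)) ⟩
  dot δ (mulVM u A)                     ≡⟨ sumℚ-cong (λ j → *-comm (δ j) (mulVM u A j)) ⟩
  dot (mulVM u A) δ                     ≡⟨ sym (∑-inner (fin n) (fin k) u A δ) ⟩
  sumℚ (λ i → u i * mulMV A δ i)        ≤⟨ sumℚ-mono (λ i → *-monoˡ-≤-0≤ (0≤u i) (Aδ≤b i)) ⟩
  dot u b                               ∎
  where open ≤-Reasoning

scenario-cost-≤ : ∀ {n k} (A : Matℚ k n) (b : Vecℚ k) (cl : Vecℚ n) {c y : Vecℚ n} {u : Vecℚ k} →
                  In𝒰 A b cl c → 𝟎 ≤v u → y ≤v mulVM u A → dot c y ≤ dot cl y + dot u b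
scenario-cost-≤ A b cl {c} {y} {u} (δ , Aδ≤b , 0≤δ , c≡cl+δ) 0≤u y≤uA = begin
  dot c y              ≡⟨ sumℚ-cong (λ j → cong (_* y j) (c≡cl+δ j)) ⟩
  dot (cl +v δ) y      ≡⟨ dot-+ˡ cl δ y ⟩
  dot cl y + dot δ y   ≤⟨ +-monoʳ-≤ (dot cl y) (weak-duality A b 0≤u y≤uA 0≤δ Aδ≤b) ⟩
  dot cl y + dot u b   ∎
  where open ≤-Reasoning

binary⇒nonneg : ∀ {n} {x : Vecℚ n} → Binary x → 𝟎 ≤v x
binary⇒nonneg bin i with bin i
... | inj₁ xᵢ≡0 = ≤-reflexive (sym xᵢ≡0)
... | inj₂ xᵢ≡1 = subst (0ℚ ≤_) (sym xᵢ≡1) 0≤1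

binary⇒≤1 : ∀ {n} {x : Vecℚ n} → Binary x → x ≤v 𝟏
binary⇒≤1 bin i with bin i
... | inj₁ xᵢ≡0 = subst (_≤ 1ℚ) (sym xᵢ≡0) 0≤1
... | inj₂ xᵢ≡1 = ≤-reflexive xᵢ≡1

binary-+ : ∀ {n} {x y : Vecℚ n} → Binary x → Binary y → (x +v y) ≤v 𝟏 → Binary (x +v y)
binary-+ {x = x} {y} bx by x+y≤1 i with bx i | by i
... | inj₁ xᵢ≡0 | inj₁ yᵢ≡0 = inj₁ (cong₂ _+_ xᵢ≡0 yᵢ≡0)
... | inj₁ xᵢ≡0 | inj₂ yᵢ≡1 = inj₂ (cong₂ _+_ xᵢ≡0 yᵢ≡1)
... | inj₂ xᵢ≡1 | inj₁ yᵢ≡0 = inj₂ (cong₂ _+_ xᵢ≡1 yᵢ≡0)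
... | inj₂ xᵢ≡1 | inj₂ yᵢ≡1 =
  ⊥-elim (<-irrefl refl (<-≤-trans 1<1+1 (subst (_≤ 1ℚ) (cong₂ _+_ xᵢ≡1 yᵢ≡1) (x+y≤1 i))))
  where
  1<1+1 : 1ℚ < 1ℚ + 1ℚ
  1<1+1 = +-monoʳ-< 1ℚ 0<1

-- The recourse LP at a fixed first stage

pattern covering r        = inj₁ r
pattern capacity j        = inj₂ (inj₁ j)
pattern recourse-nonneg j = inj₂ (inj₂ (inj₁ j))
pattern dual-feasible j   = inj₂ (inj₂ (inj₂ (inj₁ j)))
pattern dual-nonneg i     = inj₂ (inj₂ (inj₂ (inj₂ (inj₁ i))))
pattern budget            = inj₂ (inj₂ (inj₂ (inj₂ (inj₂ zero))))

pattern y-var j = inj₁ j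
pattern u-var i = inj₂ i

-- The LP relaxation of (∗) with x fixed to x₀ and cost at most v, as a system in z = (y, u).
module RecourseSystem {m n k : ℕ} (H : Matℚ m n) (g : Vecℚ m) (A : Matℚ k n) (b : Vecℚ k)
                      (cl x₀ : Vecℚ n) (v : ℚ) where

  Vars Rows : Shape
  Vars = fin n ⊕ fin k
  Rows = fin m ⊕ (fin n ⊕ (fin n ⊕ (fin n ⊕ (fin k ⊕ fin 1))))

  coefficient : Index Rows → Index Vars → ℚ
  coefficient (covering r)         (y-var j) = - H r j
  coefficient (covering r)         (u-var i) = 0ℚ
  coefficient (capacity j′)        (y-var j) = indicator j′ j
  coefficient (capacity j′)        (u-var i) = 0ℚ
  coefficient (recourse-nonneg j′) (y-var j) = - indicator j′ j
  coefficient (recourse-nonneg j′) (u-var i) = 0ℚ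
  coefficient (dual-feasible j′)   (y-var j) = indicator j′ j
  coefficient (dual-feasible j′)   (u-var i) = - A i j′
  coefficient (dual-nonneg i′)     (y-var j) = 0ℚ
  coefficient (dual-nonneg i′)     (u-var i) = - indicator i′ i
  coefficient budget               (y-var j) = cl j
  coefficient budget               (u-var i) = b i

  bounds : Vecℚ m → Vecℚ n → Vecℚ n → ℚ → Index Rows → ℚ
  bounds c d e f (covering r)        = c r
  bounds c d e f (capacity j)        = d j
  bounds c d e f (recourse-nonneg j) = 0ℚ
  bounds c d e f (dual-feasible j)   = e j
  bounds c d e f (dual-nonneg i)     = 0ℚ
  bounds c d e f budget              = f

  bound : Index Rows → ℚ
  bound = bounds (λ r → mulMV H x₀ r - g r) (λ j → 1ℚ - x₀ j) 𝟎 v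

  lhs : Vecℚ n → Vecℚ k → Index Rows → ℚ
  lhs y u (covering r)        = - dot (H r) y
  lhs y u (capacity j)        = y j
  lhs y u (recourse-nonneg j) = - y j
  lhs y u (dual-feasible j)   = y j - mulVM u A j
  lhs y u (dual-nonneg i)     = - u i
  lhs y u budget              = dot cl y + dot u b

  inner-coefficient : ∀ y u i → inner Vars (coefficient i) [ y , u ] ≡ lhs y u i
  inner-coefficient y u (covering r) =
    trans (cong₂ _+_ (sumℚ-neg (H r) y) (dot-zeroˡ u)) (+-identityʳ _)
  inner-coefficient y u (capacity j) =
    trans (cong₂ _+_ (sumℚ-indicator j y) (dot-zeroˡ u)) (+-identityʳ (y j))
  inner-coefficient y u (recourse-nonneg j) =
    trans (cong₂ _+_ (trans (sumℚ-neg (indicator j) y) (cong -_ (sumℚ-indicator j y))) (dot-zeroˡ u))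
          (+-identityʳ (- y j))
  inner-coefficient y u (dual-feasible j) =
    cong₂ _+_ (sumℚ-indicator j y)
              (trans (sumℚ-neg (λ i → A i j) u) (cong -_ (sumℚ-cong (λ i → *-comm (A i j) (u i)))))
  inner-coefficient y u (dual-nonneg i) =
    trans (cong₂ _+_ (dot-zeroˡ y) (trans (sumℚ-neg (indicator i) u) (cong -_ (sumℚ-indicator i u))))
          (+-identityˡ (- u i))
  inner-coefficient y u budget =
    cong (dot cl y +_) (sumℚ-cong (λ i → *-comm (b i) (u i)))

  solution-feasible : Binary x₀ → ∀ y u → (∀ i → inner Vars (coefficient i) [ y , u ] ≤ bound i) →
                      FeasLP H g A x₀ y u × (dot cl y + dot u b ≤ v)
  solution-feasible bin-x₀ y u h =
    ( (covered , x₀+y≤1 , y≤uA , 0≤u)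
    , binary⇒nonneg bin-x₀ , binary⇒≤1 bin-x₀ , 0≤y , (λ j → ≤-trans (y≤x₀+y j) (x₀+y≤1 j)) )
    , row budget
    where
    row : ∀ i → lhs y u i ≤ bound i
    row i = subst (_≤ bound i) (inner-coefficient y u i) (h i)
    covered : g ≤v mulMV H (y +v x₀)
    covered r = subst (g r ≤_) (trans (+-comm (mulMV H x₀ r) (dot (H r) y)) (sym (dot-+ʳ (H r) y x₀)))
                  (-a≤c-g⇒g≤c+a (dot (H r) y) (mulMV H x₀ r) (g r) (row (covering r)))
    x₀+y≤1 : (x₀ +v y) ≤v 𝟏
    x₀+y≤1 j = p≤r-q⇒q+p≤r (y j) (x₀ j) 1ℚ (row (capacity j))
    0≤y : 𝟎 ≤v y
    0≤y j = -p≤0⇒0≤p (y j) (row (recourse-nonneg j))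
    y≤uA : y ≤v mulVM u A
    y≤uA j = p-q≤0⇒p≤q (y j) (mulVM u A j) (row (dual-feasible j))
    0≤u : 𝟎 ≤v u
    0≤u i = -p≤0⇒0≤p (u i) (row (dual-nonneg i))
    y≤x₀+y : ∀ j → y j ≤ x₀ j + y j
    y≤x₀+y j = ≤-translate (y j) (+-identityˡ (y j)) refl (binary⇒nonneg bin-x₀ j)

  module Consequences (cert : Certificate coefficient bound) where
    open Certificate cert

    α : Vecℚ m
    α r = weight (covering r)
    β δ : Vecℚ n
    β j = weight (capacity j)
    δ j = weight (dual-feasible j)
    κ : ℚ
    κ = weight budget

    P : ℚ
    P = dot α (λ r → mulMV H x₀ r - g r) + dot β (λ j → 1ℚ - x₀ j)

    weighted-bounds : ∀ c d e f → ∑ Rows (λ i → weight i * bounds c d e f i) ≡ dot α c + dot β d + dot δ e + κ * f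
    weighted-bounds c d e f =
      trans (cong₂ (λ p q → dot α c + (dot β d + (p + (dot δ e + (q + (κ * f + 0ℚ))))))
                   (dot-zeroʳ (λ j → weight (recourse-nonneg j))) (dot-zeroʳ (λ i → weight (dual-nonneg i))))
            (collapse (dot α c) (dot β d) (dot δ e) (κ * f))
      where
      collapse : ∀ a b d h → a + (b + (0ℚ + (d + (0ℚ + (h + 0ℚ))))) ≡ a + b + d + h
      collapse = solve-∀ ℚ-ring

    weighted-bounds-nonneg : ∀ y u c d e f → (∀ i → lhs y u i ≤ bounds c d e f i) →
                             0ℚ ≤ dot α c + dot β d + dot δ e + κ * f
    weighted-bounds-nonneg y u c d e f lhs≤ = subst (0ℚ ≤_) (weighted-bounds c d e f)
      (weighted-bound [ y , u ] (bounds c d e f) (λ i → subst (_≤ bounds c d e f i) (sym (inner-coefficient y u i)) (lhs≤ i)))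

    P+κv<0 : P + κ * v < 0ℚ
    P+κv<0 = subst (_< 0ℚ) eq negative
      where
      eq : ∑ Rows (λ i → weight i * bound i) ≡ P + κ * v
      eq = trans (weighted-bounds _ _ 𝟎 v)
                 (trans (cong (λ t → P + t + κ * v) (dot-zeroʳ δ)) (cong (_+ κ * v) (+-identityʳ P)))

    recourse-bound : ∀ y → Inℛ H g x₀ y → - P ≤ κ * dot cl y + dot δ y
    recourse-bound y (bin-y , bin-x₀+y , covered) =
      ≤-translate (- P) (+-identityˡ (- P)) (rearrange P (dot δ y) (κ * dot cl y))
        (weighted-bounds-nonneg y 𝟎 (λ r → mulMV H x₀ r - g r) (λ j → 1ℚ - x₀ j) y (dot cl y) row)
      where
      rearrange : ∀ p d h → p + d + h + - p ≡ h + d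
      rearrange = solve-∀ ℚ-ring
      row : ∀ i → lhs y 𝟎 i ≤ bounds (λ r → mulMV H x₀ r - g r) (λ j → 1ℚ - x₀ j) y (dot cl y) i
      row (covering r)        = g≤c+a⇒-a≤c-g (dot (H r) y) (mulMV H x₀ r) (g r)
                                  (subst (g r ≤_) (dot-+ʳ (H r) x₀ y) (covered r))
      row (capacity j)        = q+p≤r⇒p≤r-q (y j) (x₀ j) 1ℚ (binary⇒≤1 bin-x₀+y j)
      row (recourse-nonneg j) = 0≤p⇒-p≤0 (y j) (binary⇒nonneg bin-y j)
      row (dual-feasible j)   = ≤-reflexive (trans (cong (λ t → y j - t) (dot-zeroˡ (λ i → A i j))) (+-identityʳ (y j)))
      row (dual-nonneg i)     = ≤-refl
      row budget              = ≤-reflexive (trans (cong (dot cl y +_) (dot-zeroˡ b)) (+-identityʳ (dot cl y)))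

    dual-bound : ∀ i → mulMV A δ i ≤ κ * b i
    dual-bound i =
      ≤-translate (mulMV A δ i) (+-identityˡ (mulMV A δ i)) (rearrange (mulMV A δ i) (κ * b i))
        (subst (0ℚ ≤_) weighted (weighted-bounds-nonneg 𝟎 (indicator i) 𝟎 𝟎 -Aᵢ (b i) row))
      where
      rearrange : ∀ a h → - a + h + a ≡ h
      rearrange = solve-∀ ℚ-ring
      -Aᵢ : Vecℚ n
      -Aᵢ j = - A i j
      weighted : dot α 𝟎 + dot β 𝟎 + dot δ -Aᵢ + κ * b i ≡ - mulMV A δ i + κ * b i
      weighted = begin
        dot α 𝟎 + dot β 𝟎 + dot δ -Aᵢ + κ * b i   ≡⟨ cong₂ (λ p q → p + q + dot δ -Aᵢ + κ * b i)
                                                             (dot-zeroʳ α) (dot-zeroʳ β) ⟩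
        0ℚ + 0ℚ + dot δ -Aᵢ + κ * b i             ≡⟨ cong (_+ κ * b i) (+-identityˡ (dot δ -Aᵢ)) ⟩
        dot δ -Aᵢ + κ * b i                       ≡⟨ cong (_+ κ * b i) (trans (sumℚ-cong (λ j → *-comm (δ j) (-Aᵢ j)))
                                                                             (sumℚ-neg (A i) δ)) ⟩
        - mulMV A δ i + κ * b i                   ∎
        where open ≡-Reasoning
      row : ∀ i′ → lhs 𝟎 (indicator i) i′ ≤ bounds 𝟎 𝟎 -Aᵢ (b i) i′
      row (covering r)        = ≤-reflexive (cong -_ (dot-zeroʳ (H r)))
      row (capacity j)        = ≤-refl
      row (recourse-nonneg j) = ≤-refl
      row (dual-feasible j)   = ≤-reflexive (trans (+-identityˡ _) (cong -_ (sumℚ-indicator i (λ i′ → A i′ j))))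
      row (dual-nonneg i′)    = 0≤p⇒-p≤0 (indicator i i′) (indicator-nonneg i i′)
      row budget              = ≤-reflexive (trans (cong₂ _+_ (dot-zeroʳ cl) (sumℚ-indicator i b)) (+-identityˡ (b i)))

    -- σ + κ T = 1 and Aδ ≤ κ b keep the mixture in 𝒰; for κ = 0, δ is a recession direction of 𝒰
    -- and T is taken large.
    module MixedScenario (δ₀ : Vecℚ n) (Aδ₀≤b : mulMV A δ₀ ≤v b) (0≤δ₀ : 𝟎 ≤v δ₀)
                   (T : ℚ) (0≤T : 0ℚ ≤ T) (κT≤1 : κ * T ≤ 1ℚ) where

      σ : ℚ
      σ = 1ℚ - κ * T

      0≤σ : 0ℚ ≤ σ
      0≤σ = ≤-translate (- (κ * T)) (+-inverseʳ (κ * T)) refl κT≤1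

      scenario : Vecℚ n
      scenario j = cl j + (σ * δ₀ j + T * δ j)

      scenario-∈𝒰 : In𝒰 A b cl scenario
      scenario-∈𝒰 = (λ j → σ * δ₀ j + T * δ j) , Aδ≤b
                  , (λ j → 0≤+0≤ (0≤*0≤ 0≤σ (0≤δ₀ j)) (0≤*0≤ 0≤T (weight-nonneg (dual-feasible j))))
                  , (λ j → refl)
        where
        distribute : ∀ a s d₀ t d → a * (s * d₀ + t * d) ≡ s * (a * d₀) + t * (a * d)
        distribute = solve-∀ ℚ-ring
        recombine : ∀ κ t b → (1ℚ - κ * t) * b + t * (κ * b) ≡ b
        recombine = solve-∀ ℚ-ring
        Aδ≤b : mulMV A (λ j → σ * δ₀ j + T * δ j) ≤v b
        Aδ≤b i = begin
          mulMV A (λ j → σ * δ₀ j + T * δ j) i         ≡⟨ trans (sumℚ-cong (λ j → distribute (A i j) σ (δ₀ j) T (δ j)))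
                                                                (sumℚ-linear σ T (λ j → A i j * δ₀ j) (λ j → A i j * δ j)) ⟩
          σ * mulMV A δ₀ i + T * mulMV A δ i           ≤⟨ +-mono-≤ (*-monoˡ-≤-0≤ 0≤σ (Aδ₀≤b i))
                                                                   (*-monoˡ-≤-0≤ 0≤T (dual-bound i)) ⟩
          σ * b i + T * (κ * b i)                      ≡⟨ recombine κ T (b i) ⟩
          b i                                          ∎
          where open ≤-Reasoning

      scenario-cost : ∀ y → dot scenario y ≡ σ * dot (cl +v δ₀) y + T * (κ * dot cl y + dot δ y)
      scenario-cost y = begin
        dot scenario y                                        ≡⟨ sumℚ-cong (λ j → split (cl j) κ T (δ₀ j) (δ j) (y j)) ⟩
        sumℚ (λ j → σ * c₀y j + T * dy j)                     ≡⟨ sumℚ-linear σ T c₀y dy ⟩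
        σ * dot (cl +v δ₀) y + T * sumℚ dy                    ≡⟨ cong (λ t → σ * dot (cl +v δ₀) y + T * t) dy-sum ⟩
        σ * dot (cl +v δ₀) y + T * (κ * dot cl y + dot δ y)   ∎
        where
        open ≡-Reasoning
        c₀y dy : Vecℚ n
        c₀y j = (cl j + δ₀ j) * y j
        dy j = κ * (cl j * y j) + δ j * y j
        dy-sum : sumℚ dy ≡ κ * dot cl y + dot δ y
        dy-sum = trans (sumℚ-+ (λ j → κ * (cl j * y j)) (λ j → δ j * y j)) (cong (_+ dot δ y) (sumℚ-*ˡ κ (λ j → cl j * y j)))
        split : ∀ c κ t d₀ d y →
                (c + ((1ℚ - κ * t) * d₀ + t * d)) * y ≡ (1ℚ - κ * t) * ((c + d₀) * y) + t * (κ * (c * y) + d * y)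
        split = solve-∀ ℚ-ring

    costly-scenario : ∀ {c₀} → In𝒰 A b cl c₀ → 𝟎 ≤v c₀ →
                      ∃ λ c → In𝒰 A b cl c × (∀ y → Inℛ H g x₀ y → v < dot c y)
    costly-scenario (δ₀ , Aδ₀≤b , 0≤δ₀ , c₀≡cl+δ₀) 0≤c₀ with choose-scale κ P v (weight-nonneg budget) P+κv<0
    ... | T , 0≤T , κT≤1 , v<T[-P] = scenario , scenario-∈𝒰 , exceeds
      where
      open MixedScenario δ₀ Aδ₀≤b 0≤δ₀ T 0≤T κT≤1
      exceeds : ∀ y → Inℛ H g x₀ y → v < dot scenario y
      exceeds y y∈ℛ = begin-strict
        v                                                      <⟨ v<T[-P] ⟩
        T * - P                                                ≤⟨ *-monoˡ-≤-0≤ 0≤T (recourse-bound y y∈ℛ) ⟩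
        T * (κ * dot cl y + dot δ y)                           ≤⟨ ≤-translate (T * (κ * dot cl y + dot δ y)) (+-identityˡ _) refl
                                                                    (0≤*0≤ 0≤σ (dot-nonneg 0≤cl+δ₀ (binary⇒nonneg (proj₁ y∈ℛ)))) ⟩
        σ * dot (cl +v δ₀) y + T * (κ * dot cl y + dot δ y)    ≡⟨ sym (scenario-cost y) ⟩
        dot scenario y                                         ∎
        where
        open ≤-Reasoning
        0≤cl+δ₀ : 𝟎 ≤v (cl +v δ₀)
        0≤cl+δ₀ j = subst (0ℚ ≤_) (c₀≡cl+δ₀ j) (0≤c₀ j)

relaxation-≯-worstCase : ∀ {m n k} (H : Matℚ m n) (g : Vecℚ m) (A : Matℚ k n) (b : Vecℚ k) (cl x₀ : Vecℚ n) (v : ℚ) →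
                   Binary x₀ → (∀ c → In𝒰 A b cl c → ∃ λ y → Inℛ H g x₀ y × (dot c y ≤ v)) →
                   ∀ {c₀} → In𝒰 A b cl c₀ → 𝟎 ≤v c₀ →
                   ¬ (∀ y u → FeasLP H g A x₀ y u → v < dot cl y + dot u b)
relaxation-≯-worstCase H g A b cl x₀ v bin-x₀ robust c₀∈𝒰 0≤c₀ above-v = no-cheap-recourse (costly-scenario c₀∈𝒰 0≤c₀)
  where
  open RecourseSystem H g A b cl x₀ v
  infeasible : ∀ z → ¬ (∀ i → inner Vars (coefficient i) z ≤ bound i)
  infeasible z h =
    let (feasible , cost≤v) = solution-feasible bin-x₀ (λ j → z (y-var j)) (λ i → z (u-var i)) h in
    <-irrefl refl (<-≤-trans (above-v (λ j → z (y-var j)) (λ i → z (u-var i)) feasible) cost≤v)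
  open Consequences (FourierMotzkin.farkas coefficient bound infeasible)
  no-cheap-recourse : ¬ (∃ λ c → In𝒰 A b cl c × (∀ y → Inℛ H g x₀ y → v < dot c y))
  no-cheap-recourse (c , c∈𝒰 , exceeds) =
    let (y , y∈ℛ , cost≤v) = robust c c∈𝒰 in <-irrefl refl (<-≤-trans (exceeds y y∈ℛ) cost≤v)

-- Bounds for the robust two-stage problem

module RobustTwoStage {m n k : ℕ} (H : Matℚ m n) (g : Vecℚ m) (A : Matℚ k n) (b : Vecℚ k) (cl C : Vecℚ n) where

  feasMIP⇒recourse : ∀ {x y u} → FeasMIP H g A x y u → Inℛ H g x y
  feasMIP⇒recourse {x} {y} ((covered , x+y≤1 , _ , _) , bin-x , bin-y) =
    bin-y , binary-+ bin-x bin-y x+y≤1 ,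
    λ r → subst (g r ≤_) (sumℚ-cong (λ j → cong (H r j *_) (+-comm (y j) (x j)))) (covered r)

  feasMIP⇒feasLP : ∀ {x y u} → FeasMIP H g A x y u → FeasLP H g A x y u
  feasMIP⇒feasLP (common , bin-x , bin-y) =
    common , binary⇒nonneg bin-x , binary⇒≤1 bin-x , binary⇒nonneg bin-y , binary⇒≤1 bin-y

  eval-≤-objMIP : ∀ {x y u e} → FeasMIP H g A x y u → IsEval H g A b cl C x e → e ≤ objMIP b cl C x y u
  eval-≤-objMIP {x} {y} {u} {e} feasible@((_ , _ , y≤uA , 0≤u) , _) (v , (_ , c , c∈𝒰 , forced) , e≡Cx+v) = begin
    e                               ≡⟨ e≡Cx+v ⟩
    dot C x + v                     ≤⟨ +-monoʳ-≤ (dot C x) (forced y (feasMIP⇒recourse feasible)) ⟩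
    dot C x + dot c y               ≤⟨ +-monoʳ-≤ (dot C x) (scenario-cost-≤ A b cl c∈𝒰 0≤u y≤uA) ⟩
    dot C x + (dot cl y + dot u b)  ≡⟨ sym (+-assoc (dot C x) (dot cl y) (dot u b)) ⟩
    objMIP b cl C x y u             ∎
    where open ≤-Reasoning

  objMIP-nonneg : ∀ {x y u c} → 𝟎 ≤v C → In𝒰 A b cl c → 𝟎 ≤v c → FeasLP H g A x y u → 0ℚ ≤ objMIP b cl C x y u
  objMIP-nonneg {x} {y} {u} {c} 0≤C c∈𝒰 0≤c ((_ , _ , y≤uA , 0≤u) , 0≤x , _ , 0≤y , _) = begin
    0ℚ                              ≤⟨ 0≤+0≤ (dot-nonneg 0≤C 0≤x) (dot-nonneg 0≤c 0≤y) ⟩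
    dot C x + dot c y               ≤⟨ +-monoʳ-≤ (dot C x) (scenario-cost-≤ A b cl c∈𝒰 0≤u y≤uA) ⟩
    dot C x + (dot cl y + dot u b)  ≡⟨ sym (+-assoc (dot C x) (dot cl y) (dot u b)) ⟩
    objMIP b cl C x y u             ∎
    where open ≤-Reasoning

  optValLP-≤-eval : ∀ {z x₀ e} → (∀ c → In𝒰 A b cl c → 𝟎 ≤v c) →
                    IsOptValLP H g A b cl C z → In𝒳' H g x₀ → IsEval H g A b cl C x₀ e → z ≤ e
  optValLP-≤-eval {z} {x₀} {e} 𝒰-nonneg (_ , z≤obj) (bin-x₀ , _) (v , (robust , c₀ , c₀∈𝒰 , _) , e≡Cx₀+v) =
    ≮⇒≥ λ e<z → relaxation-≯-worstCase H g A b cl x₀ v bin-x₀ robust c₀∈𝒰 (𝒰-nonneg c₀ c₀∈𝒰) λ y u feasible →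
      +-cancelˡ-< (dot C x₀) v (dot cl y + dot u b)
        (<-≤-trans (subst (_< z) e≡Cx₀+v e<z)
                   (≤-trans (z≤obj x₀ y u feasible) (≤-reflexive (+-assoc (dot C x₀) (dot cl y) (dot u b)))))

  optValLP-nonneg : ∀ {z c} → 𝟎 ≤v C → In𝒰 A b cl c → 𝟎 ≤v c → IsOptValLP H g A b cl C z → 0ℚ ≤ z
  optValLP-nonneg {z} 0≤C c∈𝒰 0≤c ((_ , _ , _ , feasible , obj≡z) , _) =
    subst (0ℚ ≤_) obj≡z (objMIP-nonneg 0≤C c∈𝒰 0≤c feasible)

theorem6 : (n m k : ℕ) (H : Matℚ m n) (g : Vecℚ m) (C : Vecℚ n)
           (A : Matℚ k n) (b : Vecℚ k) (cl : Vecℚ n) →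
           𝟎 ≤v C →
           (∀ c → In𝒰 A b cl c → 𝟎 ≤v c) →
           (∃ λ M → ∀ c → In𝒰 A b cl c → c ≤v (λ _ → M)) →
           (xs ys : Vecℚ n) (us : Vecℚ k) →
           IsOptMIP H g A b cl C xs ys us →
           (zLP : ℚ) → IsOptValLP H g A b cl C zLP → .{{_ : NonZero zLP}} →
           In𝒳' H g xs ×
           (∀ e opt → IsEval H g A b cl C xs e → IsOptEval H g A b cl C opt →
             e ≤ (objMIP b cl C xs ys us ÷ zLP) * opt)
theorem6 n m k H g C A b cl 0≤C 𝒰-nonneg _ xs ys us (feasible@(_ , bin-xs , _) , _) zLP zLP-opt =
  (bin-xs , ys , feasMIP⇒recourse feasible) , ratio-bound
  where
  open RobustTwoStage H g A b cl C
  ratio-bound : ∀ e opt → IsEval H g A b cl C xs e → IsOptEval H g A b cl C opt →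
                e ≤ (objMIP b cl C xs ys us ÷ zLP) * opt
  ratio-bound e opt xs-eval@(_ , (_ , c , c∈𝒰 , _) , _) ((x₀ , x₀∈𝒳′ , x₀-eval) , _) =
    ≤-÷-* 0<zLP (proj₂ zLP-opt xs ys us (feasMIP⇒feasLP feasible)) (eval-≤-objMIP feasible xs-eval)
          (optValLP-≤-eval 𝒰-nonneg zLP-opt x₀∈𝒳′ x₀-eval)
    where
    0<zLP : 0ℚ < zLP
    0<zLP = positive⁻¹ zLP {{nonNeg∧nonZero⇒pos zLP {{nonNegative 0≤zLP}}}}
      where
      0≤zLP : 0ℚ ≤ zLP
      0≤zLP = optValLP-nonneg 0≤C c∈𝒰 (𝒰-nonneg c c∈𝒰) zLP-opt
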